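{- Work intuitionistically. A complete lattice $L$ is the frame $\Omega X$ of an o-algebra $X$ if and only if there exists a symmetric relation $\mathrel{>\!\!<}$ on $L$ such that for all $x,y,z\in L$ and all families $(y_i)_{i\in I}$ in $L$: (a) $(x\wedge z)\mathrel{>\!\!<} y$ iff $x\mathrel{>\!\!<}(z\wedge y)$; (b) $x\mathrel{>\!\!<}\bigvee_{i\in I}y_i$ iff there exists $i\in I$ with $x\mathrel{>\!\!<} y_i$; (c) $x\le y$ iff for all $z\in L$, $z\mathrel{>\!\!<} x$ implies $z\mathrel{>\!\!<} y$.
   Context: A frame is a complete lattice satisfying $x\wedge\bigvee_i y_i\le\bigvee_i(x\wedge y_i)$; a locale $X$ is given by its frame $\Omega X$. $\Omega$ is the frame of truth values (power set of a singleton), and $\Omega!_X:\Omega\to\Omega X$ is $\Omega!_X(p)=\bigvee\{x\in\Omega X\mid x=1\text{ and }p=1\}$. $X$ is overt if $\Omega!_X$ has a left adjoint $\mathrm{Pos}_X:\Omega X\to\Omega$. An overlap algebra (o-algebra) is an overt locale $X$ such that for all $x,y\in\Omega X$: if $\mathrm{Pos}_X(z\wedge x)\le\mathrm{Pos}_X(z\wedge y)$ for all $z\in\Omega X$, then $x\le y$. -}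

module Defs where

open import Level using (Level; _⊔_; suc)
open import Data.Product using (Σ; _×_; _,_)
open import Relation.Binary.Structures using (IsPartialOrder)
open import Function.Bundles using (_⇔_)

-- Binary meets and the top element exist in any complete lattice; they
-- are recorded as fields (with their universal properties, which
-- determine them up to ≈) for convenience.
record CompleteLattice (c ℓ ι : Level) : Set (suc (c ⊔ ℓ ⊔ ι)) where
  infix  4 _≈_ _≤_
  infixr 7 _∧_
  field
    Carrier        : Set c
    _≈_            : Carrier → Carrier → Set ℓ
    _≤_            : Carrier → Carrier → Set ℓ
    isPartialOrder : IsPartialOrder _≈_ _≤_
    ⋁              : {I : Set ι} → (I → Carrier) → Carrier
    ⋁-upper        : {I : Set ι} (f : I → Carrier) (i : I) → f i ≤ ⋁ f
    ⋁-least        : {I : Set ι} (f : I → Carrier) (u : Carrier) →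
                     ((i : I) → f i ≤ u) → ⋁ f ≤ u
    _∧_            : Carrier → Carrier → Carrier
    ∧-lower₁       : (x y : Carrier) → x ∧ y ≤ x
    ∧-lower₂       : (x y : Carrier) → x ∧ y ≤ y
    ∧-greatest     : (x y z : Carrier) → z ≤ x → z ≤ y → z ≤ x ∧ y
    ⊤              : Carrier
    ⊤-maximum      : (x : Carrier) → x ≤ ⊤

module _ {c ℓ ι : Level} (L : CompleteLattice c ℓ ι) where
  open CompleteLattice L

  IsFrame : Set (c ⊔ ℓ ⊔ suc ι)
  IsFrame = {I : Set ι} (x : Carrier) (y : I → Carrier) →
            x ∧ ⋁ y ≤ ⋁ (λ i → x ∧ y i)

  -- The frame Ω of truth values is represented by Set ι (propositions as
  -- types), ordered by implication.  Ω!(p) = ⋁ { x | x = 1 and p },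
  -- i.e. the join of the family indexed by (proofs of) p with constant value ⊤.
  Ω! : Set ι → Carrier
  Ω! p = ⋁ {I = p} (λ _ → ⊤)

  IsLeftAdjointOfΩ! : (Carrier → Set ι) → Set (c ⊔ ℓ ⊔ suc ι)
  IsLeftAdjointOfΩ! Pos = (x : Carrier) (p : Set ι) → (Pos x → p) ⇔ (x ≤ Ω! p)

  Overt : Set (c ⊔ ℓ ⊔ suc ι)
  Overt = Σ (Carrier → Set ι) IsLeftAdjointOfΩ!

  IsOAlgebra : Set (c ⊔ ℓ ⊔ suc ι)
  IsOAlgebra =
    IsFrame ×
    Σ (Carrier → Set ι) (λ Pos →
      IsLeftAdjointOfΩ! Pos ×
      ((x y : Carrier) →
        ((z : Carrier) → Pos (z ∧ x) → Pos (z ∧ y)) → x ≤ y))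

  IsOverlapRelation : (Carrier → Carrier → Set ι) → Set (c ⊔ ℓ ⊔ suc ι)
  IsOverlapRelation _><_ =
    ((x y : Carrier) → x >< y → y >< x) ×
    ((x y z : Carrier) → ((x ∧ z) >< y) ⇔ (x >< (z ∧ y))) ×
    ({I : Set ι} (x : Carrier) (y : I → Carrier) →
      (x >< ⋁ y) ⇔ Σ I (λ i → x >< y i)) ×
    ((x y : Carrier) → (x ≤ y) ⇔ ((z : Carrier) → z >< x → z >< y))

-- Given an o-algebra, x >< y := Pos (x ∧ y) is the overlap relation: symmetry
-- and (a) hold because Pos is monotone, (b) because Pos, being a left adjoint,
-- preserves joins and the frame law moves the meet inside, and (c) is exactly
-- the o-algebra axiom.  Conversely, from an overlap relation put Pos x := x >< ⊤.
-- By (c) every inequality a ≤ b reduces to "z >< a implies z >< b"; with (a)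
-- and (b) this yields the frame law, the adjunction Pos ⊣ Ω!, and the
-- o-algebra axiom.
module Submission where

open import Defs
open import Level using (Level)
open import Data.Product using (Σ; _,_; proj₁; proj₂)
open import Function.Bundles using (_⇔_; mk⇔; Equivalence)
open import Relation.Binary.Structures using (IsPartialOrder)

module _ {c ℓ ι : Level} (L : CompleteLattice c ℓ ι) where
  open CompleteLattice L
  open IsPartialOrder isPartialOrder using (refl; trans)
  open Equivalence

  ∧-comm-≤ : ∀ x y → x ∧ y ≤ y ∧ x
  ∧-comm-≤ x y = ∧-greatest y x (x ∧ y) (∧-lower₂ x y) (∧-lower₁ x y)

  ∧-assocʳ-≤ : ∀ x y z → (x ∧ y) ∧ z ≤ x ∧ (y ∧ z)
  ∧-assocʳ-≤ x y z = ∧-greatest x (y ∧ z) _ (trans (∧-lower₁ _ _) (∧-lower₁ x y))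
    (∧-greatest y z _ (trans (∧-lower₁ _ _) (∧-lower₂ x y)) (∧-lower₂ _ _))

  ∧-assocˡ-≤ : ∀ x y z → x ∧ (y ∧ z) ≤ (x ∧ y) ∧ z
  ∧-assocˡ-≤ x y z = ∧-greatest (x ∧ y) z _
    (∧-greatest x y _ (∧-lower₁ _ _) (trans (∧-lower₂ _ _) (∧-lower₁ y z)))
    (trans (∧-lower₂ _ _) (∧-lower₂ y z))

  ∧-monoʳ-≤ : ∀ x {y y'} → y ≤ y' → x ∧ y ≤ x ∧ y'
  ∧-monoʳ-≤ x {y} le = ∧-greatest x _ _ (∧-lower₁ x y) (trans (∧-lower₂ x y) le)

  ≤-∧-⊤ : ∀ x → x ≤ x ∧ ⊤
  ≤-∧-⊤ x = ∧-greatest x ⊤ x refl (⊤-maximum x)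

  module LeftAdjointOfΩ! {Pos : Carrier → Set ι} (adj : IsLeftAdjointOfΩ! L Pos) where

    -- The identity on Pos y transposes to y ≤ Ω! (Pos y); precompose with x ≤ y.
    Pos-mono : ∀ {x y} → x ≤ y → Pos x → Pos y
    Pos-mono {x} {y} le = from (adj x (Pos y)) (trans le (to (adj y (Pos y)) (λ p → p)))

    Pos-⋁ : {I : Set ι} (f : I → Carrier) → Pos (⋁ f) → Σ I (λ i → Pos (f i))
    Pos-⋁ {I} f = from (adj (⋁ f) (Σ I (λ i → Pos (f i))))
      (⋁-least f _ (λ i → to (adj (f i) _) (λ q → i , q)))

  oAlgebra⇒overlapRelation : IsOAlgebra L → Σ (Carrier → Carrier → Set ι) (IsOverlapRelation L)
  oAlgebra⇒overlapRelation (distrib , Pos , adj , separates) =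
    _><_ , ><-sym , ><-∧-shift , ><-⋁ , ≤⇔><-mono
    where
    open LeftAdjointOfΩ! adj

    _><_ : Carrier → Carrier → Set ι
    x >< y = Pos (x ∧ y)

    ><-sym : ∀ x y → x >< y → y >< x
    ><-sym x y = Pos-mono (∧-comm-≤ x y)

    ><-∧-shift : ∀ x y z → ((x ∧ z) >< y) ⇔ (x >< (z ∧ y))
    ><-∧-shift x y z = mk⇔ (Pos-mono (∧-assocʳ-≤ x z y)) (Pos-mono (∧-assocˡ-≤ x z y))

    ><-⋁ : {I : Set ι} (x : Carrier) (y : I → Carrier) → (x >< ⋁ y) ⇔ Σ I (λ i → x >< y i)
    ><-⋁ x y = mk⇔ (λ h → Pos-⋁ (λ i → x ∧ y i) (Pos-mono (distrib x y) h))
      (λ (i , h) → Pos-mono (∧-monoʳ-≤ x (⋁-upper y i)) h)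

    ≤⇔><-mono : ∀ x y → (x ≤ y) ⇔ ((z : Carrier) → z >< x → z >< y)
    ≤⇔><-mono x y = mk⇔ (λ le z → Pos-mono (∧-monoʳ-≤ z le)) (separates x y)

  module OverlapRelation {_><_ : Carrier → Carrier → Set ι} (isOverlap : IsOverlapRelation L _><_) where
    private
      ><-sym : ∀ x y → x >< y → y >< x
      ><-sym = proj₁ isOverlap

      ><-∧-shift : ∀ x y z → ((x ∧ z) >< y) ⇔ (x >< (z ∧ y))
      ><-∧-shift = proj₁ (proj₂ isOverlap)

      ><-⋁ : {I : Set ι} (x : Carrier) (y : I → Carrier) → (x >< ⋁ y) ⇔ Σ I (λ i → x >< y i)
      ><-⋁ = proj₁ (proj₂ (proj₂ isOverlap))

      ≤⇔><-mono : ∀ x y → (x ≤ y) ⇔ ((z : Carrier) → z >< x → z >< y)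
      ≤⇔><-mono = proj₂ (proj₂ (proj₂ isOverlap))

    ><-monoʳ : ∀ {z x y} → x ≤ y → z >< x → z >< y
    ><-monoʳ {z} {x} {y} le = to (≤⇔><-mono x y) le z

    isFrame : IsFrame L
    isFrame x y = from (≤⇔><-mono _ _) λ z h →
      let (i , h') = to (><-⋁ (z ∧ x) y) (from (><-∧-shift z (⋁ y) x) h)
      in from (><-⋁ z (λ i → x ∧ y i)) (i , to (><-∧-shift z (y i) x) h')

    Pos : Carrier → Set ι
    Pos x = x >< ⊤

    -- Ω! p is a join of copies of ⊤ indexed by proofs of p, so by (b)
    -- z >< Ω! p amounts to z >< ⊤ together with a proof of p.
    Pos-isLeftAdjointOfΩ! : IsLeftAdjointOfΩ! L Pos
    Pos-isLeftAdjointOfΩ! x p = mk⇔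
      (λ h → from (≤⇔><-mono x (Ω! L p)) λ z zx →
        from (><-⋁ z (λ _ → ⊤)) (h (><-monoʳ (⊤-maximum z) (><-sym _ _ zx)) , ><-monoʳ (⊤-maximum x) zx))
      (λ le h → proj₁ (to (><-⋁ ⊤ (λ _ → ⊤)) (><-monoʳ le (><-sym _ _ h))))

    Pos-separates : ∀ x y → ((z : Carrier) → Pos (z ∧ x) → Pos (z ∧ y)) → x ≤ y
    Pos-separates x y hyp = from (≤⇔><-mono x y) λ z zx →
      ><-monoʳ (∧-lower₁ y ⊤)
        (to (><-∧-shift z ⊤ y) (hyp z (from (><-∧-shift z ⊤ x) (><-monoʳ (≤-∧-⊤ x) zx))))

  overlapRelation⇒oAlgebra : Σ (Carrier → Carrier → Set ι) (IsOverlapRelation L) → IsOAlgebra L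
  overlapRelation⇒oAlgebra (_ , isOverlap) = isFrame , Pos , Pos-isLeftAdjointOfΩ! , Pos-separates
    where open OverlapRelation isOverlap

proposition3p2 : {c ℓ ι : Level} (L : CompleteLattice c ℓ ι) →
    IsOAlgebra L ⇔ Σ (CompleteLattice.Carrier L → CompleteLattice.Carrier L → Set ι) (IsOverlapRelation L)
proposition3p2 L = mk⇔ (oAlgebra⇒overlapRelation L) (overlapRelation⇒oAlgebra L)
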